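{- Let $\Gamma$ be a distance-regular graph with diameter $D\ge3$ that is neither bipartite nor almost bipartite. Let $\sigma_0,\dots,\sigma_D$ and $\rho_0,\dots,\rho_D$ be nontrivial pseudo cosine sequences that form a tight pair, and suppose $\varepsilon=1$ is an auxiliary parameter for this pair, i.e. $\sigma_i\rho_i-\sigma_{i-1}\rho_{i-1}=\sigma_{i-1}\rho_i-\sigma_i\rho_{i-1}$ for $1\le i\le D$. Then: (i) $\rho_i=(-1)^i$ for $0\le i\le D-1$ and $\rho_D\ne(-1)^D$; (ii) $\sigma_{D-1}=\sigma_D$; (iii) $a_i=0$ for $0\le i\le D-2$ and $a_{D-1}\ne0$.
   Context: $\Gamma$ is a finite, undirected, connected graph without loops or multiple edges, with path-length distance $\partial$ and diameter $D$. It is distance-regular: for all $0\le h,i,j\le D$ and all vertices $x,y$ with $\partial(x,y)=h$, the number $p^h_{ij}$ of vertices $z$ with $\partial(x,z)=i$, $\partial(y,z)=j$ depends only on $h,i,j$. Write $a_i=p^i_{1i}$, $b_i=p^i_{1,i+1}$ $(0\le i\le D-1)$, $c_i=p^i_{1,i-1}$ $(1\le i\le D)$, $c_0=0$, $b_D=0$, $k=b_0$. $\Gamma$ is bipartite if $a_i=0$ for $0\le i\le D$, almost bipartite if $a_D\ne0$ and $a_i=0$ for $0\le i\le D-1$. A pseudo cosine sequence (for $\theta\in\mathbb{R}$) is a sequence of reals $\sigma_0,\dots,\sigma_D$ with $\sigma_0=1$ and $c_i\sigma_{i-1}+a_i\sigma_i+b_i\sigma_{i+1}=\theta\sigma_i$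 for $0\le i\le D-1$ (with $c_0\sigma_{ -1}=0$). It is trivial if it is the one for $\theta=k$ (all entries $1$), nontrivial otherwise. Two pseudo cosine sequences $\sigma_i,\rho_i$ form a tight pair if $\sigma_0\rho_0,\dots,\sigma_D\rho_D$ is a pseudo cosine sequence; an auxiliary parameter of a tight pair of nontrivial sequences is a real $\varepsilon$ with $\sigma_i\rho_i-\sigma_{i-1}\rho_{i-1}=\varepsilon(\sigma_{i-1}\rho_i-\sigma_i\rho_{i-1})$ for $1\le i\le D$. -}

module Defs where

open import Level using (0ℓ)
open import Data.Nat using (ℕ; zero; suc; _∸_)
open Data.Nat using (_≤_; _<_)
open import Data.Bool using (Bool; true; false; _∧_; _∨_; not; T)
open import Data.Fin using (Fin; _≟_)
open import Data.List using (List; length; filter; allFin)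
open import Data.Bool.ListAction using (any)
open import Data.Product using (_×_; ∃; ∃-syntax; _,_)
open import Data.Sum using (_⊎_)
open import Relation.Nullary using (¬_; does)
open import Relation.Nullary.Decidable using (T?)
open import Relation.Binary.PropositionalEquality using (_≡_; _≢_)
open import Relation.Binary.Structures using (IsStrictTotalOrder)
open import Algebra.Structures using (IsCommutativeRing)

-- The real numbers, given axiomatically as a complete ordered field
-- (any model is isomorphic to ℝ).

record RealField : Set₁ where
  infixl 6 _+_
  infixl 7 _*_
  infix 4 _<ᵣ_
  field
    ℝ    : Set
    _+_  : ℝ → ℝ → ℝ
    _*_  : ℝ → ℝ → ℝ
    -_   : ℝ → ℝ
    0r   : ℝ
    1r   : ℝ
    isCommutativeRing : IsCommutativeRing _≡_ _+_ _*_ -_ 0r 1r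
    inv     : (x : ℝ) → x ≢ 0r → ℝ
    inverse : (x : ℝ) (p : x ≢ 0r) → x * inv x p ≡ 1r
    0≢1     : 0r ≢ 1r
    _<ᵣ_  : ℝ → ℝ → Set
    isStrictTotalOrder : IsStrictTotalOrder _≡_ _<ᵣ_
    +-mono-< : ∀ {x y} z → x <ᵣ y → x + z <ᵣ y + z
    *-pos    : ∀ {x y} → 0r <ᵣ x → 0r <ᵣ y → 0r <ᵣ x * y

    -- least upper bound property (x ≤ y written as x <ᵣ y ⊎ x ≡ y)
    lub : (P : ℝ → Set) → ∃ P → (∃[ u ] (∀ x → P x → (x <ᵣ u ⊎ x ≡ u))) →
          ∃[ s ] ((∀ x → P x → (x <ᵣ s ⊎ x ≡ s)) ×
                  (∀ u → (∀ x → P x → (x <ᵣ u ⊎ x ≡ u)) → (s <ᵣ u ⊎ s ≡ u)))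

  fromℕ : ℕ → ℝ
  fromℕ zero    = 0r
  fromℕ (suc n) = 1r + fromℕ n

  negOnePow : ℕ → ℝ
  negOnePow zero    = 1r
  negOnePow (suc i) = - negOnePow i

record Graph : Set where
  field
    n   : ℕ
    adj : Fin n → Fin n → Bool
    symmetric   : ∀ x y → adj x y ≡ adj y x
    irreflexive : ∀ x → adj x x ≡ false

module _ (Γ : Graph) where
  open Graph Γ

  within : ℕ → Fin n → Fin n → Bool
  within zero    x y = does (x ≟ y)
  within (suc d) x y = within d x y ∨ any (λ z → within d x z ∧ adj z y) (allFin n)

  distIs : Fin n → Fin n → ℕ → Bool
  distIs x y zero    = within zero x y
  distIs x y (suc d) = within (suc d) x y ∧ not (within d x y)

  Connected : Set
  Connected = ∀ x y → ∃[ d ] T (within d x y)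

  HasDiameter : ℕ → Set
  HasDiameter D = (∀ x y → T (within D x y)) × ∃[ x ] ∃[ y ] T (distIs x y D)

  count : Fin n → Fin n → ℕ → ℕ → ℕ
  count x y i j = length (filter (λ z → T? (distIs x z i ∧ distIs y z j)) (allFin n))

  IsDistanceRegular : ℕ → (ℕ → ℕ → ℕ → ℕ) → Set
  IsDistanceRegular D p =
    Connected × HasDiameter D ×
    (∀ h i j → h ≤ D → i ≤ D → j ≤ D → ∀ x y →
       T (distIs x y h) → count x y i j ≡ p h i j)

module Params (p : ℕ → ℕ → ℕ → ℕ) where
  a : ℕ → ℕ
  a i = p i 1 i
  b : ℕ → ℕ
  b i = p i 1 (suc i)
  -- c i for i ≥ 1; c 0 = 0 by convention
  c : ℕ → ℕ
  c zero    = 0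
  c (suc i) = p (suc i) 1 i

module Seqs (R : RealField) (D : ℕ) (p : ℕ → ℕ → ℕ → ℕ) where
  open RealField R
  open Params p

  -- σ is a pseudo cosine sequence for θ (indices 0..D matter)
  IsPseudoCosineFor : ℝ → (ℕ → ℝ) → Set
  IsPseudoCosineFor θ σ =
    σ 0 ≡ 1r ×
    (0 < D → fromℕ (a 0) * σ 0 + fromℕ (b 0) * σ 1 ≡ θ * σ 0) ×
    (∀ i → suc i < D →
       fromℕ (c (suc i)) * σ i + fromℕ (a (suc i)) * σ (suc i)
         + fromℕ (b (suc i)) * σ (suc (suc i)) ≡ θ * σ (suc i))

  IsPseudoCosine : (ℕ → ℝ) → Set
  IsPseudoCosine σ = ∃[ θ ] IsPseudoCosineFor θ σ

  -- trivial: the sequence for θ = k, i.e. all entries 1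
  Nontrivial : (ℕ → ℝ) → Set
  Nontrivial σ = ¬ (∀ i → i ≤ D → σ i ≡ 1r)

  TightPair : (ℕ → ℝ) → (ℕ → ℝ) → Set
  TightPair σ ρ = IsPseudoCosine σ × IsPseudoCosine ρ × IsPseudoCosine (λ i → σ i * ρ i)

  IsAuxiliary : (ℕ → ℝ) → (ℕ → ℝ) → ℝ → Set
  IsAuxiliary σ ρ ε = ∀ i → 1 ≤ i → i ≤ D →
    σ i * ρ i + - (σ (i ∸ 1) * ρ (i ∸ 1)) ≡ ε * (σ (i ∸ 1) * ρ i + - (σ i * ρ (i ∸ 1)))

module Submission where

-- With ε = 1 the auxiliary relation factors as (σᵢ₊₁ − σᵢ)(ρᵢ + ρᵢ₊₁) = 0.
-- Nontriviality of σ gives σ₁ ≠ σ₀ (σ₁ = 1 would force θ = k), so ρ₁ = −1 and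
-- ρ belongs to θ′ = −k. For θ′ = −k the recurrence becomes
--   cᵢ sᵢ₋₁ + 2aᵢ ρᵢ + bᵢ sᵢ = 0,   sᵢ = ρᵢ + ρᵢ₊₁,
-- so sᵢ = 0 and ρᵢ = (−1)ⁱ up to the first t with aₜ ≠ 0, while sₜ ≠ 0 forces
-- σₜ₊₁ = σₜ. As Γ is neither bipartite nor almost bipartite, t < D. If t + 1 < D,
-- combining the equations at t and t + 1 gives sₜ₊₁ ≠ 0, so σ is constant on
-- t, t + 1, t + 2; the recurrence at t + 1 then makes σₜ = σₜ₊₁ = 0, which a
-- three-term recurrence with cᵢ ≠ 0 and σ₀ = 1 does not allow. Hence D = t + 1.

open import Defs
open import Data.Nat using (ℕ; _≤_; _<_; _∸_)
open import Data.Product using (_×_; ∃)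
open import Relation.Nullary using (¬_)
open import Relation.Binary.PropositionalEquality using (_≡_; _≢_)

open import Level using (0ℓ)
open import Algebra.Bundles using (CommutativeRing)
import Algebra.Solver.Ring as RingSolver
open import Algebra.Solver.Ring.AlmostCommutativeRing
  using (fromCommutativeRing; _-Raw-AlmostCommutative⟶_)
open import Data.Bool using (Bool; true; false; T; _∧_; if_then_else_)
open import Data.Bool.Properties using (T-∨; T-∧; T-not-≡; T-≡)
open import Data.Empty using (⊥-elim)
open import Data.Fin using (Fin; _≟_)
open import Data.Integer as ℤ using (ℤ; -[1+_]; _⊖_; _◃_)
import Data.Integer.Properties as ℤ
open import Data.List using (List; []; _∷_; length; filter; allFin)
open import Data.List.Properties using (filter-some; filter-none)
open import Data.List.Membership.Propositional using (lose)
open import Data.List.Membership.Propositional.Properties using (∈-allFin)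
import Data.List.Relation.Unary.All as All
open import Data.List.Relation.Unary.Any using (satisfied)
open import Data.List.Relation.Unary.Any.Properties using (any⁺; any⁻)
open import Data.Maybe using (Maybe; just; nothing)
open import Data.Nat as ℕ using (zero; suc; z≤n; s≤s; _≤′_)
import Data.Nat.Properties as ℕ
open import Data.Nat.Tactic.RingSolver using (solve-∀)
open import Data.Product using (_,_; proj₁; proj₂; ∃-syntax)
import Data.Sign as Sign
open import Data.Sum using (_⊎_; inj₁; inj₂; [_,_]′)
open import Data.Unit using (tt)
open import Function using (_∘_; Equivalence)
open import Relation.Binary.Definitions using (tri<; tri≈; tri>)
open import Relation.Binary.PropositionalEquality as ≡
  using (refl; sym; trans; cong; cong₂; subst; subst₂; module ≡-Reasoning)
open import Relation.Binary.Structures using (IsStrictTotalOrder)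
open import Relation.Nullary using (Dec; yes; no)
open import Relation.Nullary.Decidable using (T?; dec-true)

open Equivalence using (to; from)

-- The ring solver needs coefficients whose equality can be decided, so we
-- instantiate it with ℤ along the canonical homomorphism into a commutative ring.
module IntegerCoefficientSolver {c ℓ} (R : CommutativeRing c ℓ) where
  open CommutativeRing R renaming (refl to ≈-refl; sym to ≈-sym; trans to ≈-trans)
  open import Algebra.Properties.Ring ring
    using (-‿distribˡ-*; -‿distribʳ-*; -‿involutive; -0#≈0#; -‿+-comm)
  open import Algebra.Properties.Semiring.Mult semiring
    using (×-homo-+; ×1-homo-*) renaming (_×_ to _×ᵣ_)
  open import Relation.Binary.Reasoning.Setoid setoid

  fromℤ : ℤ → Carrier
  fromℤ (ℤ.+ n)  = n ×ᵣ 1#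
  fromℤ -[1+ n ] = - (suc n ×ᵣ 1#)

  ⊖-homo : ∀ m n → fromℤ (m ⊖ n) ≈ m ×ᵣ 1# - n ×ᵣ 1#
  ⊖-homo zero    zero    = ≈-sym (≈-trans (+-congˡ -0#≈0#) (+-identityʳ 0#))
  ⊖-homo zero    (suc n) = ≈-sym (+-identityˡ _)
  ⊖-homo (suc m) zero    = ≈-sym (≈-trans (+-congˡ -0#≈0#) (+-identityʳ _))
  ⊖-homo (suc m) (suc n) = begin
    fromℤ (suc m ⊖ suc n)                 ≡⟨ ≡.cong fromℤ (ℤ.[1+m]⊖[1+n]≡m⊖n m n) ⟩
    fromℤ (m ⊖ n)                         ≈⟨ ⊖-homo m n ⟩
    m ×ᵣ 1# - n ×ᵣ 1#                     ≈⟨ +-congˡ (≈-sym (+-identityˡ _)) ⟩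
    m ×ᵣ 1# + (0# - n ×ᵣ 1#)              ≈⟨ +-congˡ (+-congʳ (≈-sym (-‿inverseʳ 1#))) ⟩
    m ×ᵣ 1# + ((1# - 1#) - n ×ᵣ 1#)       ≈⟨ +-congˡ (+-assoc _ _ _) ⟩
    m ×ᵣ 1# + (1# + (- 1# - n ×ᵣ 1#))     ≈⟨ +-assoc _ _ _ ⟨
    (m ×ᵣ 1# + 1#) + (- 1# - n ×ᵣ 1#)     ≈⟨ +-cong (+-comm _ _) (-‿+-comm _ _) ⟩
    suc m ×ᵣ 1# - suc n ×ᵣ 1#             ∎

  +-homo : ∀ i j → fromℤ (i ℤ.+ j) ≈ fromℤ i + fromℤ j
  +-homo (ℤ.+ m)  (ℤ.+ n)  = ×-homo-+ 1# m n
  +-homo (ℤ.+ m)  -[1+ n ] = ⊖-homo m (suc n)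
  +-homo -[1+ m ] (ℤ.+ n)  = ≈-trans (⊖-homo n (suc m)) (+-comm _ _)
  +-homo -[1+ m ] -[1+ n ] = begin
    - (suc (suc (m ℕ.+ n)) ×ᵣ 1#)         ≡⟨ ≡.cong (λ k → - (suc k ×ᵣ 1#)) (ℕ.+-suc m n) ⟨
    - ((suc m ℕ.+ suc n) ×ᵣ 1#)           ≈⟨ -‿cong (×-homo-+ 1# (suc m) (suc n)) ⟩
    - (suc m ×ᵣ 1# + suc n ×ᵣ 1#)         ≈⟨ -‿+-comm _ _ ⟨
    - (suc m ×ᵣ 1#) - suc n ×ᵣ 1#         ∎

  -‿homo : ∀ i → fromℤ (ℤ.- i) ≈ - fromℤ i
  -‿homo -[1+ n ]      = ≈-sym (-‿involutive _)
  -‿homo (ℤ.+ zero)    = ≈-sym -0#≈0#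
  -‿homo (ℤ.+ suc n)   = ≈-refl

  +◃-homo : ∀ n → fromℤ (Sign.+ ◃ n) ≈ n ×ᵣ 1#
  +◃-homo zero    = ≈-refl
  +◃-homo (suc n) = ≈-refl

  -◃-homo : ∀ n → fromℤ (Sign.- ◃ n) ≈ - (n ×ᵣ 1#)
  -◃-homo zero    = ≈-sym -0#≈0#
  -◃-homo (suc n) = ≈-refl

  *-homo : ∀ i j → fromℤ (i ℤ.* j) ≈ fromℤ i * fromℤ j
  *-homo (ℤ.+ m)  (ℤ.+ n)  = ≈-trans (+◃-homo (m ℕ.* n)) (×1-homo-* m n)
  *-homo (ℤ.+ m)  -[1+ n ] = begin
    fromℤ (Sign.- ◃ (m ℕ.* suc n))        ≈⟨ -◃-homo (m ℕ.* suc n) ⟩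
    - ((m ℕ.* suc n) ×ᵣ 1#)               ≈⟨ -‿cong (×1-homo-* m (suc n)) ⟩
    - (m ×ᵣ 1# * suc n ×ᵣ 1#)             ≈⟨ -‿distribʳ-* _ _ ⟩
    m ×ᵣ 1# * - (suc n ×ᵣ 1#)             ∎
  *-homo -[1+ m ] (ℤ.+ n)  = begin
    fromℤ (Sign.- ◃ (suc m ℕ.* n))        ≈⟨ -◃-homo (suc m ℕ.* n) ⟩
    - ((suc m ℕ.* n) ×ᵣ 1#)               ≈⟨ -‿cong (×1-homo-* (suc m) n) ⟩
    - (suc m ×ᵣ 1# * n ×ᵣ 1#)             ≈⟨ -‿distribˡ-* _ _ ⟩
    - (suc m ×ᵣ 1#) * n ×ᵣ 1#             ∎
  *-homo -[1+ m ] -[1+ n ] = begin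
    (suc m ℕ.* suc n) ×ᵣ 1#               ≈⟨ ×1-homo-* (suc m) (suc n) ⟩
    x * y                                 ≈⟨ -‿involutive _ ⟨
    - - (x * y)                           ≈⟨ -‿cong (-‿distribʳ-* x y) ⟩
    - (x * - y)                           ≈⟨ -‿distribˡ-* x (- y) ⟩
    - x * - y                             ∎
    where
    x y : Carrier
    x = suc m ×ᵣ 1#
    y = suc n ×ᵣ 1#

  homomorphism : ℤ.+-*-rawRing -Raw-AlmostCommutative⟶ fromCommutativeRing R
  homomorphism = record
    { ⟦_⟧    = fromℤ
    ; +-homo = +-homo
    ; *-homo = *-homo
    ; -‿homo = -‿homo
    ; 0-homo = ≈-refl
    ; 1-homo = +-identityʳ 1#
    }

  fromℤ-≟ : ∀ i j → Maybe (fromℤ i ≈ fromℤ j)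
  fromℤ-≟ i j with i ℤ.≟ j
  ... | yes ≡.refl = just ≈-refl
  ... | no _       = nothing

  open RingSolver ℤ.+-*-rawRing (fromCommutativeRing R) homomorphism fromℤ-≟ public

indicator : Bool → ℕ
indicator b = if b then 1 else 0

module _ {A : Set} where
  open Data.Nat using (_+_)

  -- Defs.count Γ x y i j is definitionally countTrue _ (allFin n).
  countTrue : (A → Bool) → List A → ℕ
  countTrue f xs = length (filter (T? ∘ f) xs)

  countTrue-∷ : ∀ f x xs → countTrue f (x ∷ xs) ≡ indicator (f x) + countTrue f xs
  countTrue-∷ f x xs with f x
  ... | true  = refl
  ... | false = refl

  countTrue-partition₃ : ∀ {f g₁ g₂ g₃ : A → Bool} →
    (∀ x → indicator (f x) ≡ indicator (g₁ x) + indicator (g₂ x) + indicator (g₃ x)) →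
    ∀ xs → countTrue f xs ≡ countTrue g₁ xs + countTrue g₂ xs + countTrue g₃ xs
  countTrue-partition₃ split [] = refl
  countTrue-partition₃ {f} {g₁} {g₂} {g₃} split (x ∷ xs) = begin
    countTrue f (x ∷ xs)
      ≡⟨ countTrue-∷ f x xs ⟩
    indicator (f x) + countTrue f xs
      ≡⟨ cong₂ _+_ (split x) (countTrue-partition₃ split xs) ⟩
    (indicator (g₁ x) + indicator (g₂ x) + indicator (g₃ x))
      + (countTrue g₁ xs + countTrue g₂ xs + countTrue g₃ xs)
      ≡⟨ interleave (indicator (g₁ x)) (indicator (g₂ x)) (indicator (g₃ x)) _ _ _ ⟩
    (indicator (g₁ x) + countTrue g₁ xs) + (indicator (g₂ x) + countTrue g₂ xs)
      + (indicator (g₃ x) + countTrue g₃ xs)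
      ≡⟨ cong₂ _+_ (cong₂ _+_ (countTrue-∷ g₁ x xs) (countTrue-∷ g₂ x xs)) (countTrue-∷ g₃ x xs) ⟨
    countTrue g₁ (x ∷ xs) + countTrue g₂ (x ∷ xs) + countTrue g₃ (x ∷ xs) ∎
    where
    open ≡-Reasoning
    interleave : ∀ a b c d e f → (a + b + c) + (d + e + f) ≡ (a + d) + (b + e) + (c + f)
    interleave = solve-∀

≤-≤2+⇒≡∨≡1+∨≡2+ : ∀ {m n} → m ≤ n → n ≤ suc (suc m) → n ≡ m ⊎ n ≡ suc m ⊎ n ≡ suc (suc m)
≤-≤2+⇒≡∨≡1+∨≡2+ {zero}  {zero}                z≤n _                 = inj₁ refl
≤-≤2+⇒≡∨≡1+∨≡2+ {zero}  {suc zero}            z≤n _                 = inj₂ (inj₁ refl)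
≤-≤2+⇒≡∨≡1+∨≡2+ {zero}  {suc (suc zero)}      z≤n _                 = inj₂ (inj₂ refl)
≤-≤2+⇒≡∨≡1+∨≡2+ {zero}  {suc (suc (suc n))}   z≤n (s≤s (s≤s ()))
≤-≤2+⇒≡∨≡1+∨≡2+ {suc m} {suc n} (s≤s m≤n) (s≤s n≤2+m) with ≤-≤2+⇒≡∨≡1+∨≡2+ m≤n n≤2+m
... | inj₁ n≡m          = inj₁ (cong suc n≡m)
... | inj₂ (inj₁ n≡1+m) = inj₂ (inj₁ (cong suc n≡1+m))
... | inj₂ (inj₂ n≡2+m) = inj₂ (inj₂ (cong suc n≡2+m))

least-failure : ∀ {P : ℕ → Set} → (∀ i → Dec (P i)) → ∀ n →
  (∀ i → i < n → P i) ⊎ ∃[ t ] (t < n × ¬ P t × (∀ i → i < t → P i))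
least-failure P? zero    = inj₁ (λ _ ())
least-failure P? (suc n) with least-failure P? n
... | inj₂ (t , t<n , ¬Pt , below) = inj₂ (t , ℕ.m≤n⇒m≤1+n t<n , ¬Pt , below)
... | inj₁ below with P? n
...   | no ¬Pn = inj₂ (n , ℕ.≤-refl , ¬Pn , below)
...   | yes Pn = inj₁ λ i i<1+n → case (ℕ.m≤n⇒m<n∨m≡n (ℕ.≤-pred i<1+n))
  where
  case : ∀ {i} → i < n ⊎ i ≡ n → _
  case (inj₁ i<n) = below _ i<n
  case (inj₂ refl) = Pn

module Distance (Γ : Graph) where
  open Graph Γ
  open Data.Nat using (_+_)

  record Within (d : ℕ) (x y : Fin n) : Set where
    constructor mkWithin
    field holds : T (within Γ d x y)

  record Dist (x y : Fin n) (d : ℕ) : Set where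
    constructor mkDist
    field holds : T (distIs Γ x y d)

  private
    variable
      d e : ℕ
      x y z w : Fin n

  within-zero⁻ : Within 0 x y → x ≡ y
  within-zero⁻ {x} {y} (mkWithin h) with x ≟ y
  ... | yes x≡y = x≡y

  within-refl : Within 0 x x
  within-refl {x} = mkWithin (from T-≡ (dec-true (x ≟ x) refl))

  within-suc : Within d x y → Within (suc d) x y
  within-suc (mkWithin h) = mkWithin (from T-∨ (inj₁ h))

  within-step : Within d x w → T (adj w y) → Within (suc d) x y
  within-step {w = w} (mkWithin h) w~y =
    mkWithin (from T-∨ (inj₂ (any⁺ _ (lose (∈-allFin w) (from T-∧ (h , w~y))))))

  within-suc⁻ : Within (suc d) x y → Within d x y ⊎ ∃[ w ] (Within d x w × T (adj w y))
  within-suc⁻ {d} {x} {y} (mkWithin h) with to T-∨ h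
  ... | inj₁ h′ = inj₁ (mkWithin h′)
  ... | inj₂ h′ with satisfied (any⁻ _ (allFin n) h′)
  ... | w , hw = let (x~w , w~y) = to T-∧ hw in inj₂ (w , mkWithin x~w , w~y)

  within-mono : d ≤ e → Within d x y → Within e x y
  within-mono d≤e = go (ℕ.≤⇒≤′ d≤e)
    where
    go : d ≤′ e → Within d x y → Within e x y
    go ℕ.≤′-refl       h = h
    go (ℕ.≤′-step d≤e) h = within-suc (go d≤e h)

  within-trans : Within d x y → Within e y z → Within (e + d) x z
  within-trans {e = zero}  h h′ = subst (Within _ _) (within-zero⁻ h′) h
  within-trans {e = suc e} h h′ with within-suc⁻ h′
  ... | inj₁ h″             = within-suc (within-trans h h″)
  ... | inj₂ (w , hw , w~z) = within-step (within-trans h hw) w~z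

  adj-sym : T (adj x y) → T (adj y x)
  adj-sym {x} {y} = subst T (symmetric x y)

  within-sym : Within d x y → Within d y x
  within-sym {zero}  h = subst (λ z → Within 0 z _) (within-zero⁻ h) within-refl
  within-sym {suc d} {x} {y} h with within-suc⁻ h
  ... | inj₁ h′             = within-suc (within-sym h′)
  ... | inj₂ (w , hw , w~y) =
    subst (λ k → Within k y x) (ℕ.+-comm d 1) (within-trans (within-step within-refl (adj-sym w~y)) (within-sym hw))

  dist⇒within : Dist x y d → Within d x y
  dist⇒within {d = zero}  (mkDist h) = mkWithin h
  dist⇒within {d = suc d} (mkDist h) = mkWithin (proj₁ (to T-∧ h))

  dist⇒¬within : Dist x y e → d < e → ¬ Within d x y
  dist⇒¬within {e = suc e} (mkDist h) (s≤s d≤e) w =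
    subst T (to T-not-≡ (proj₂ (to T-∧ h))) (Within.holds (within-mono d≤e w))

  within⇒dist-suc : Within (suc d) x y → ¬ Within d x y → Dist x y (suc d)
  within⇒dist-suc (mkWithin h) ¬w =
    mkDist (from T-∧ (h , from T-not-≡ (¬T⇒≡false (λ h′ → ¬w (mkWithin h′)))))
    where
    ¬T⇒≡false : ∀ {b} → ¬ T b → b ≡ false
    ¬T⇒≡false {false} _  = refl
    ¬T⇒≡false {true}  ¬t = ⊥-elim (¬t tt)

  dist-unique : Dist x y d → Dist x y e → d ≡ e
  dist-unique {d = d} {e = e} hd he with ℕ.<-cmp d e
  ... | tri< d<e _ _ = ⊥-elim (dist⇒¬within he d<e (dist⇒within hd))
  ... | tri≈ _ d≡e _ = d≡e
  ... | tri> _ _ e<d = ⊥-elim (dist⇒¬within hd e<d (dist⇒within he))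

  dist-sym : Dist x y d → Dist y x d
  dist-sym {d = zero}  h = mkDist (Within.holds (within-sym (dist⇒within h)))
  dist-sym {d = suc d} h =
    within⇒dist-suc (within-sym (dist⇒within h)) (λ w → dist⇒¬within h ℕ.≤-refl (within-sym w))

  within⇒dist : Within d x y → ∃[ e ] (e ≤ d × Dist x y e)
  within⇒dist {zero}  (mkWithin h) = 0 , z≤n , mkDist h
  within⇒dist {suc d} {x} {y} h with T? (within Γ d x y)
  ... | yes h′ = let (e , e≤d , he) = within⇒dist (mkWithin {d} {x} {y} h′) in e , ℕ.m≤n⇒m≤1+n e≤d , he
  ... | no ¬h′ = suc d , ℕ.≤-refl , within⇒dist-suc h (λ w → ¬h′ (Within.holds w))

  dist-suc⇒dist-pred : Dist x z (suc d) → Within d x w → T (adj w z) → Dist x w d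
  dist-suc⇒dist-pred {d = zero}  _ (mkWithin h) _   = mkDist h
  dist-suc⇒dist-pred {d = suc d} h hw           w~z =
    within⇒dist-suc hw (λ h′ → dist⇒¬within h ℕ.≤-refl (within-step h′ w~z))

  dist-pred : Dist x z (suc d) → ∃[ w ] (Dist x w d × T (adj w z))
  dist-pred h with within-suc⁻ (dist⇒within h)
  ... | inj₁ h′             = ⊥-elim (dist⇒¬within h ℕ.≤-refl h′)
  ... | inj₂ (w , hw , w~z) = w , dist-suc⇒dist-pred h hw w~z , w~z

  adj⇒dist₁ : T (adj x y) → Dist x y 1
  adj⇒dist₁ {x} {y} x~y = within⇒dist-suc (within-step within-refl x~y)
    (λ h → subst T (irreflexive y) (subst (λ u → T (adj u y)) (within-zero⁻ h) x~y))

  dist₁⇒adj : Dist x y 1 → T (adj x y)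
  dist₁⇒adj h with proj₂ (dist-pred h)
  ... | hw , w~y = subst (λ u → T (adj u _)) (sym (within-zero⁻ (dist⇒within hw))) w~y

  dist-refl : Dist x x 0
  dist-refl {x} = mkDist (Within.holds (within-refl {x}))

  dist-true : Dist x y d → distIs Γ x y d ≡ true
  dist-true (mkDist h) = to T-≡ h

  dist-false : Dist x y d → e ≢ d → distIs Γ x y e ≡ false
  dist-false {x = x} {y} {e = e} h e≢d with distIs Γ x y e in eq
  ... | false = refl
  ... | true  = ⊥-elim (e≢d (dist-unique (mkDist (subst T (sym eq) tt)) h))

  neighbour-dist : Dist x y (suc d) → T (adj x z) →
                   Dist y z d ⊎ Dist y z (suc d) ⊎ Dist y z (suc (suc d))
  neighbour-dist {d = d} hxy x~z
    with e , e≤2+d , hyz ← within⇒dist (within-step (dist⇒within (dist-sym hxy)) x~z)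
    with ≤-≤2+⇒≡∨≡1+∨≡2+ (ℕ.≮⇒≥ (λ e<d → dist⇒¬within (dist-sym hxy) (ℕ.n<1+n d)
                             (within-mono e<d (within-step (dist⇒within hyz) (adj-sym x~z))))) e≤2+d
  ... | inj₁ refl        = inj₁ hyz
  ... | inj₂ (inj₁ refl) = inj₂ (inj₁ hyz)
  ... | inj₂ (inj₂ refl) = inj₂ (inj₂ hyz)

module IntersectionNumbers {Γ : Graph} {D : ℕ} {p : ℕ → ℕ → ℕ → ℕ}
                           (drg : IsDistanceRegular Γ D p) where
  open Graph Γ
  open Distance Γ
  open Params p
  open Data.Nat using (_+_)

  private
    variable
      h i j : ℕ
      x y : Fin n

  count≡p : h ≤ D → i ≤ D → j ≤ D → Dist x y h → count Γ x y i j ≡ p h i j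
  count≡p h≤D i≤D j≤D (mkDist hxy) = proj₂ (proj₂ drg) _ _ _ h≤D i≤D j≤D _ _ hxy

  dist-exists : i ≤ D → ∃[ x ] ∃[ y ] Dist x y i
  dist-exists {i} i≤D = go (D ∸ i) i (ℕ.m∸n+n≡m i≤D)
    where
    go : ∀ k i → k + i ≡ D → ∃[ x ] ∃[ y ] Dist x y i
    go zero    i refl with _ , x , y , hxy ← proj₁ (proj₂ drg) = x , y , mkDist hxy
    go (suc k) i k+1+i≡D with x , y , hxy ← go k (suc i) (trans (ℕ.+-suc k i) k+1+i≡D)
                        with w , hxw , _ ← dist-pred hxy = x , w , hxw

  witness⇒p≢0 : Dist x y h → h ≤ D → i ≤ D → j ≤ D → ∀ z →
              T (distIs Γ x z i ∧ distIs Γ y z j) → p h i j ≢ 0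
  witness⇒p≢0 hxy h≤D i≤D j≤D z hz p≡0 =
    ℕ.<⇒≢ (filter-some (λ z → T? _) (lose (∈-allFin z) hz)) (sym (trans (count≡p h≤D i≤D j≤D hxy) p≡0))

  a₀≡0 : 1 ≤ D → a 0 ≡ 0
  a₀≡0 1≤D with x , _ ← dist-exists {0} z≤n =
    trans (sym (count≡p z≤n 1≤D z≤n (dist-refl {x})))
          (cong length (filter-none (λ z → T? (distIs Γ x z 1 ∧ distIs Γ x z 0)) (All.universal not-both (allFin n))))
    where
    not-both : ∀ z → ¬ T (distIs Γ x z 1 ∧ distIs Γ x z 0)
    not-both z hz with h₁ , h₀ ← to T-∧ hz
                  with () ← dist-unique (mkDist {x} {z} {1} h₁) (mkDist {x} {z} {0} h₀)

  b≢0 : i < D → b i ≢ 0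
  b≢0 {i} i<D with y , z , hyz ← dist-exists i<D with w , hyw , w~z ← dist-pred hyz =
    witness⇒p≢0 (dist-sym hyw) (ℕ.<⇒≤ i<D) 1≤D i<D z
      (from T-∧ (Dist.holds (adj⇒dist₁ w~z) , Dist.holds hyz))
    where 1≤D = ℕ.≤-trans (s≤s z≤n) i<D

  c≢0 : suc i ≤ D → c (suc i) ≢ 0
  c≢0 {i} 1+i≤D with y , x , hyx ← dist-exists 1+i≤D with w , hyw , w~x ← dist-pred hyx =
    witness⇒p≢0 (dist-sym hyx) 1+i≤D (ℕ.≤-trans (s≤s z≤n) 1+i≤D) (ℕ.≤-trans (ℕ.n≤1+n i) 1+i≤D) w
      (from T-∧ (Dist.holds (adj⇒dist₁ (adj-sym w~x)) , Dist.holds hyw))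

  a+b+c≡k : suc i < D → a (suc i) + b (suc i) + c (suc i) ≡ b 0
  a+b+c≡k {i} 1+i<D with x , y , hxy ← dist-exists (ℕ.<⇒≤ 1+i<D) = begin
    a m + b m + c m
      ≡⟨ cong₂ _+_ (cong₂ _+_ (count≡p m≤D 1≤D m≤D hxy) (count≡p m≤D 1≤D 1+i<D hxy))
                   (count≡p m≤D 1≤D i≤D hxy) ⟨
    count Γ x y 1 m + count Γ x y 1 (suc m) + count Γ x y 1 i
      ≡⟨ countTrue-partition₃ split (allFin n) ⟨
    count Γ x x 1 1
      ≡⟨ count≡p z≤n 1≤D 1≤D (dist-refl {x}) ⟩
    b 0 ∎
    where
    open ≡-Reasoning
    m : ℕ
    m = suc i
    m≤D : m ≤ D
    m≤D = ℕ.<⇒≤ 1+i<D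
    1≤D : 1 ≤ D
    1≤D = ℕ.≤-trans (s≤s z≤n) m≤D
    i≤D : i ≤ D
    i≤D = ℕ.≤-trans (ℕ.n≤1+n i) m≤D
    i<2+i : i < suc m
    i<2+i = ℕ.m<n⇒m<1+n (ℕ.n<1+n i)
    near : Fin n → Bool
    near z = distIs Γ x z 1
    split : ∀ z → indicator (near z ∧ near z) ≡ indicator (near z ∧ distIs Γ y z m)
                  + indicator (near z ∧ distIs Γ y z (suc m)) + indicator (near z ∧ distIs Γ y z i)
    split z with near z in x~z
    ... | false = refl
    ... | true with neighbour-dist hxy (dist₁⇒adj (mkDist (subst T (sym x~z) tt)))
    ... | inj₁ hyz rewrite dist-true hyz | dist-false hyz (ℕ.1+n≢n {i})
                         | dist-false hyz (ℕ.>⇒≢ i<2+i) = refl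
    ... | inj₂ (inj₁ hyz) rewrite dist-true hyz | dist-false hyz (ℕ.<⇒≢ (ℕ.n<1+n i))
                                | dist-false hyz (ℕ.1+n≢n {m}) = refl
    ... | inj₂ (inj₂ hyz) rewrite dist-true hyz | dist-false hyz (ℕ.<⇒≢ (ℕ.n<1+n m))
                                | dist-false hyz (ℕ.<⇒≢ i<2+i) = refl

module FieldArithmetic (R : RealField) where
  open RealField R

  commutativeRing : CommutativeRing 0ℓ 0ℓ
  commutativeRing = record { isCommutativeRing = isCommutativeRing }

  open CommutativeRing commutativeRing public
    using (_-_; +-comm; *-comm; *-identityˡ; +-identityˡ; +-identityʳ; *-identityʳ; zeroˡ; zeroʳ; -‿inverseʳ)
  open IntegerCoefficientSolver commutativeRing public
    using (Polynomial; solve; _:=_; _:+_; _:*_; :-_; _:-_; con)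
  open import Algebra.Properties.Group (CommutativeRing.+-group commutativeRing) public
    using (x∙y⁻¹≈ε⇒x≈y; x≈y⇒x∙y⁻¹≈ε; inverseʳ-unique)
  open import Algebra.Properties.Semiring.Mult (CommutativeRing.semiring commutativeRing)
    using (×-homo-+; ×1-homo-*) renaming (_×_ to _×ᵣ_)
  open IsStrictTotalOrder isStrictTotalOrder using (compare; irrefl) renaming (trans to <-trans)

  :0 : ∀ {n} → Polynomial n
  :0 = con (ℤ.+ 0)

  x-y≡0⇒x≡y : ∀ {x y} → x - y ≡ 0r → x ≡ y
  x-y≡0⇒x≡y = x∙y⁻¹≈ε⇒x≈y _ _

  x≡y⇒x-y≡0 : ∀ {x y} → x ≡ y → x - y ≡ 0r
  x≡y⇒x-y≡0 = x≈y⇒x∙y⁻¹≈ε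

  x*y≡0⇒y≡0 : ∀ {x y} → x ≢ 0r → x * y ≡ 0r → y ≡ 0r
  x*y≡0⇒y≡0 {x} {y} x≢0 xy≡0 = begin
    y                 ≡⟨ *-identityʳ y ⟨
    y * 1r            ≡⟨ cong (y *_) (inverse x x≢0) ⟨
    y * (x * x⁻¹)     ≡⟨ solve 3 (λ x y x⁻¹ → y :* (x :* x⁻¹) := (x :* y) :* x⁻¹) refl x y x⁻¹ ⟩
    (x * y) * x⁻¹     ≡⟨ cong (_* x⁻¹) xy≡0 ⟩
    0r * x⁻¹          ≡⟨ zeroˡ x⁻¹ ⟩
    0r                ∎
    where
    open ≡-Reasoning
    x⁻¹ : ℝ
    x⁻¹ = inv x x≢0

  *-cancelˡ : ∀ {x y z} → x ≢ 0r → x * y ≡ x * z → y ≡ z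
  *-cancelˡ {x} {y} {z} x≢0 xy≡xz = x-y≡0⇒x≡y (x*y≡0⇒y≡0 x≢0 (begin
    x * (y - z)        ≡⟨ solve 3 (λ x y z → x :* (y :- z) := x :* y :- x :* z) refl x y z ⟩
    x * y - x * z      ≡⟨ x≡y⇒x-y≡0 xy≡xz ⟩
    0r                 ∎))
    where open ≡-Reasoning

  x*x≡1⇒x≢0 : ∀ {x} → x * x ≡ 1r → x ≢ 0r
  x*x≡1⇒x≢0 {x} x*x≡1 refl = 0≢1 (trans (sym (zeroˡ 0r)) x*x≡1)

  0<1 : 0r <ᵣ 1r
  0<1 with compare 0r 1r
  ... | tri< 0<1 _ _ = 0<1
  ... | tri≈ _ 0≡1 _ = ⊥-elim (0≢1 0≡1)
  ... | tri> _ _ 1<0 = ⊥-elim (irrefl refl (<-trans (subst (0r <ᵣ_) -1*-1≡1 (*-pos 0<-1 0<-1)) 1<0))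
    where
    0<-1 : 0r <ᵣ - 1r
    0<-1 = subst₂ _<ᵣ_ (-‿inverseʳ 1r) (+-identityˡ (- 1r)) (+-mono-< (- 1r) 1<0)
    -1*-1≡1 : - 1r * - 1r ≡ 1r
    -1*-1≡1 = trans (solve 1 (λ u → :- u :* :- u := u :* u) refl 1r) (*-identityʳ 1r)

  0<fromℕ-suc : ∀ n → 0r <ᵣ fromℕ (suc n)
  0<fromℕ-suc zero    = subst (0r <ᵣ_) (sym (+-identityʳ 1r)) 0<1
  0<fromℕ-suc (suc n) =
    <-trans 0<1 (subst₂ _<ᵣ_ (+-identityˡ 1r) (+-comm _ 1r) (+-mono-< 1r (0<fromℕ-suc n)))

  fromℕ≢0 : ∀ {n} → n ≢ 0 → fromℕ n ≢ 0r
  fromℕ≢0 {zero}  n≢0 _    = n≢0 refl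
  fromℕ≢0 {suc n} _   n≡0 = irrefl refl (subst (0r <ᵣ_) n≡0 (0<fromℕ-suc n))

  fromℕ≡×1 : ∀ n → fromℕ n ≡ n ×ᵣ 1r
  fromℕ≡×1 zero    = refl
  fromℕ≡×1 (suc n) = cong (1r +_) (fromℕ≡×1 n)

  fromℕ-+ : ∀ m n → fromℕ (m ℕ.+ n) ≡ fromℕ m + fromℕ n
  fromℕ-+ m n rewrite fromℕ≡×1 (m ℕ.+ n) | fromℕ≡×1 m | fromℕ≡×1 n = ×-homo-+ 1r m n

  fromℕ-* : ∀ m n → fromℕ (m ℕ.* n) ≡ fromℕ m * fromℕ n
  fromℕ-* m n rewrite fromℕ≡×1 (m ℕ.* n) | fromℕ≡×1 m | fromℕ≡×1 n = ×1-homo-* m n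

  negOnePow²≡1 : ∀ i → negOnePow i * negOnePow i ≡ 1r
  negOnePow²≡1 zero    = *-identityʳ 1r
  negOnePow²≡1 (suc i) = trans (solve 1 (λ u → :- u :* :- u := u :* u) refl (negOnePow i)) (negOnePow²≡1 i)

  negOnePow≢0 : ∀ i → negOnePow i ≢ 0r
  negOnePow≢0 i = x*x≡1⇒x≢0 (negOnePow²≡1 i)

  two-step-obstruction : ∀ {a b a′ b′ c′ r r′ s′} →
    (a + a) * r + b * (r + r′) ≡ 0r → c′ * (r + r′) + (a′ + a′) * r′ + b′ * s′ ≡ 0r → s′ ≡ 0r →
    (c′ * (a + a) + (a′ + a′) * (b + a + a)) * r ≡ 0r
  two-step-obstruction {a} {b} {a′} {b′} {c′} {r} {r′} {s′} h₁ h₂ s′≡0 = begin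
    (c′ * (a + a) + (a′ + a′) * (b + a + a)) * r
      ≡⟨ solve 8 (λ a b a′ b′ c′ r r′ s′ →
           (c′ :* (a :+ a) :+ (a′ :+ a′) :* (b :+ a :+ a)) :* r :=
           (c′ :+ (a′ :+ a′)) :* ((a :+ a) :* r :+ b :* (r :+ r′))
             :- b :* (c′ :* (r :+ r′) :+ (a′ :+ a′) :* r′ :+ b′ :* s′) :+ b :* (b′ :* s′))
           refl a b a′ b′ c′ r r′ s′ ⟩
    (c′ + (a′ + a′)) * ((a + a) * r + b * (r + r′))
      - b * (c′ * (r + r′) + (a′ + a′) * r′ + b′ * s′) + b * (b′ * s′)
      ≡⟨ cong₂ (λ u v → (c′ + (a′ + a′)) * u - b * v + b * (b′ * s′)) h₁ h₂ ⟩
    (c′ + (a′ + a′)) * 0r - b * 0r + b * (b′ * s′)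
      ≡⟨ cong (λ u → (c′ + (a′ + a′)) * 0r - b * 0r + b * (b′ * u)) s′≡0 ⟩
    (c′ + (a′ + a′)) * 0r - b * 0r + b * (b′ * 0r)
      ≡⟨ solve 4 (λ a′ b b′ c′ → (c′ :+ (a′ :+ a′)) :* :0 :- b :* :0 :+ b :* (b′ :* :0) := :0)
                 refl a′ b b′ c′ ⟩
    0r ∎
    where open ≡-Reasoning

module PseudoCosines (R : RealField) {D : ℕ} {p : ℕ → ℕ → ℕ → ℕ}
  (a₀≡0 : Params.a p 0 ≡ 0)
  (b≢0 : ∀ {i} → i < D → Params.b p i ≢ 0)
  (c≢0 : ∀ {i} → suc i ≤ D → Params.c p (suc i) ≢ 0)
  (a+b+c≡k : ∀ {i} → suc i < D →
             Params.a p (suc i) ℕ.+ Params.b p (suc i) ℕ.+ Params.c p (suc i) ≡ Params.b p 0)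
  where
  open Params p
  open RealField R
  open FieldArithmetic R
  open Seqs R D p

  A B C : ℕ → ℝ
  A i = fromℕ (a i)
  B i = fromℕ (b i)
  C i = fromℕ (c i)

  k : ℝ
  k = B 0

  k≡A+B+C : ∀ {i} → suc i < D → k ≡ A (suc i) + B (suc i) + C (suc i)
  k≡A+B+C {i} lt = begin
    k                                               ≡⟨ cong fromℕ (a+b+c≡k lt) ⟨
    fromℕ (a (suc i) ℕ.+ b (suc i) ℕ.+ c (suc i))   ≡⟨ fromℕ-+ (a (suc i) ℕ.+ b (suc i)) (c (suc i)) ⟩
    fromℕ (a (suc i) ℕ.+ b (suc i)) + C (suc i)     ≡⟨ cong (_+ C (suc i)) (fromℕ-+ (a (suc i)) (b (suc i))) ⟩
    A (suc i) + B (suc i) + C (suc i)               ∎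
    where open ≡-Reasoning

  module _ {θ : ℝ} {σ : ℕ → ℝ} (σ-cos : IsPseudoCosineFor θ σ) where
    private
      σ₀≡1 : σ 0 ≡ 1r
      σ₀≡1 = proj₁ σ-cos
      recurrence₀ : 0 < D → A 0 * σ 0 + B 0 * σ 1 ≡ θ * σ 0
      recurrence₀ = proj₁ (proj₂ σ-cos)
      recurrence : ∀ i → suc i < D →
        C (suc i) * σ i + A (suc i) * σ (suc i) + B (suc i) * σ (suc (suc i)) ≡ θ * σ (suc i)
      recurrence = proj₂ (proj₂ σ-cos)

    θ≡k*σ₁ : 0 < D → θ ≡ k * σ 1
    θ≡k*σ₁ 0<D = begin
      θ                          ≡⟨ *-identityʳ θ ⟨
      θ * 1r                     ≡⟨ cong (θ *_) σ₀≡1 ⟨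
      θ * σ 0                    ≡⟨ recurrence₀ 0<D ⟨
      A 0 * σ 0 + k * σ 1        ≡⟨ cong (λ x → fromℕ x * σ 0 + k * σ 1) a₀≡0 ⟩
      0r * σ 0 + k * σ 1         ≡⟨ cong (_+ k * σ 1) (zeroˡ (σ 0)) ⟩
      0r + k * σ 1               ≡⟨ +-identityˡ (k * σ 1) ⟩
      k * σ 1                    ∎
      where open ≡-Reasoning

    recurrence-differences : ∀ {i} → suc i < D →
      C (suc i) * (σ i - σ (suc i)) + B (suc i) * (σ (suc (suc i)) - σ (suc i)) ≡ (θ - k) * σ (suc i)
    recurrence-differences {i} lt = begin
      c′ * (x - y) + b′ * (z - y)
        ≡⟨ solve 6 (λ a′ b′ c′ x y z → c′ :* (x :- y) :+ b′ :* (z :- y) :=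
                                       (c′ :* x :+ a′ :* y :+ b′ :* z) :- (a′ :+ b′ :+ c′) :* y)
                   refl a′ b′ c′ x y z ⟩
      (c′ * x + a′ * y + b′ * z) - (a′ + b′ + c′) * y
        ≡⟨ cong₂ (λ u v → u - v * y) (sym (recurrence i lt)) (k≡A+B+C lt) ⟨
      θ * y - k * y
        ≡⟨ solve 3 (λ θ k y → θ :* y :- k :* y := (θ :- k) :* y) refl θ k y ⟩
      (θ - k) * y ∎
      where
      open ≡-Reasoning
      a′ b′ c′ x y z : ℝ
      a′ = A (suc i); b′ = B (suc i); c′ = C (suc i)
      x = σ i; y = σ (suc i); z = σ (suc (suc i))

    recurrence-sums : ∀ {i} → suc i < D →
      C (suc i) * (σ i + σ (suc i)) + (A (suc i) + A (suc i)) * σ (suc i) + B (suc i) * (σ (suc i) + σ (suc (suc i)))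
        ≡ (θ + k) * σ (suc i)
    recurrence-sums {i} lt = begin
      c′ * (x + y) + (a′ + a′) * y + b′ * (y + z)
        ≡⟨ solve 6 (λ a′ b′ c′ x y z → c′ :* (x :+ y) :+ (a′ :+ a′) :* y :+ b′ :* (y :+ z) :=
                                       (c′ :* x :+ a′ :* y :+ b′ :* z) :+ (a′ :+ b′ :+ c′) :* y)
                   refl a′ b′ c′ x y z ⟩
      (c′ * x + a′ * y + b′ * z) + (a′ + b′ + c′) * y
        ≡⟨ cong₂ (λ u v → u + v * y) (sym (recurrence i lt)) (k≡A+B+C lt) ⟨
      θ * y + k * y
        ≡⟨ solve 3 (λ θ k y → θ :* y :+ k :* y := (θ :+ k) :* y) refl θ k y ⟩
      (θ + k) * y ∎
      where
      open ≡-Reasoning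
      a′ b′ c′ x y z : ℝ
      a′ = A (suc i); b′ = B (suc i); c′ = C (suc i)
      x = σ i; y = σ (suc i); z = σ (suc (suc i))

    θ≡k⇒σ-steady : θ ≡ k → ∀ {i} → suc i < D → σ i ≡ σ (suc i) → σ (suc i) ≡ σ (suc (suc i))
    θ≡k⇒σ-steady θ≡k {i} lt σᵢ≡σᵢ₊₁ = sym (x-y≡0⇒x≡y (x*y≡0⇒y≡0 (fromℕ≢0 (b≢0 lt)) (begin
      b′ * (z - y)                   ≡⟨ +-identityˡ _ ⟨
      0r + b′ * (z - y)              ≡⟨ cong (_+ b′ * (z - y)) c′*[x-y]≡0 ⟨
      c′ * (x - y) + b′ * (z - y)    ≡⟨ recurrence-differences lt ⟩
      (θ - k) * y                    ≡⟨ cong (_* y) (x≡y⇒x-y≡0 θ≡k) ⟩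
      0r * y                         ≡⟨ zeroˡ y ⟩
      0r                             ∎)))
      where
      open ≡-Reasoning
      b′ c′ x y z : ℝ
      b′ = B (suc i); c′ = C (suc i)
      x = σ i; y = σ (suc i); z = σ (suc (suc i))
      c′*[x-y]≡0 : c′ * (x - y) ≡ 0r
      c′*[x-y]≡0 = trans (cong (c′ *_) (x≡y⇒x-y≡0 σᵢ≡σᵢ₊₁)) (zeroʳ c′)

    θ≡k⇒trivial : 0 < D → θ ≡ k → ∀ i → i ≤ D → σ i ≡ 1r
    θ≡k⇒trivial 0<D θ≡k = all-one
      where
      σ₁≡1 : σ 1 ≡ 1r
      σ₁≡1 = *-cancelˡ (fromℕ≢0 (b≢0 0<D)) (trans (sym (θ≡k*σ₁ 0<D)) (trans θ≡k (sym (*-identityʳ k))))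
      steady : ∀ i → suc i ≤ D → σ i ≡ σ (suc i)
      steady zero    _  = trans σ₀≡1 (sym σ₁≡1)
      steady (suc i) lt = θ≡k⇒σ-steady θ≡k lt (steady i (ℕ.<⇒≤ lt))
      all-one : ∀ i → i ≤ D → σ i ≡ 1r
      all-one zero    _  = σ₀≡1
      all-one (suc i) le = trans (sym (steady i le)) (all-one i (ℕ.<⇒≤ le))

    no-consecutive-zeros : ∀ i → i < D → σ i ≡ 0r → σ (suc i) ≢ 0r
    no-consecutive-zeros zero    _  σ₀≡0 _ = 0≢1 (trans (sym σ₀≡0) σ₀≡1)
    no-consecutive-zeros (suc i) lt σᵢ₊₁≡0 σᵢ₊₂≡0 =
      no-consecutive-zeros i (ℕ.<⇒≤ lt) (x*y≡0⇒y≡0 (fromℕ≢0 (c≢0 (ℕ.<⇒≤ lt))) (begin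
        c′ * σ i                       ≡⟨ solve 4 (λ a′ b′ c′ x → c′ :* x := c′ :* x :+ a′ :* :0 :+ b′ :* :0)
                                                  refl a′ b′ c′ (σ i) ⟩
        c′ * σ i + a′ * 0r + b′ * 0r   ≡⟨ subst₂ (λ u v → c′ * σ i + a′ * u + b′ * v ≡ θ * u)
                                                 σᵢ₊₁≡0 σᵢ₊₂≡0 (recurrence i lt) ⟩
        θ * 0r                         ≡⟨ zeroʳ θ ⟩
        0r                             ∎)) σᵢ₊₁≡0
      where
      open ≡-Reasoning
      a′ b′ c′ : ℝ
      a′ = A (suc i); b′ = B (suc i); c′ = C (suc i)

    module _ (nontrivial : Nontrivial σ) where
      θ≢k : 0 < D → θ ≢ k
      θ≢k 0<D θ≡k = nontrivial (θ≡k⇒trivial 0<D θ≡k)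

      σ₁≢1 : 0 < D → σ 1 ≢ 1r
      σ₁≢1 0<D σ₁≡1 = θ≢k 0<D (trans (θ≡k*σ₁ 0<D) (trans (cong (k *_) σ₁≡1) (*-identityʳ k)))

  module AuxiliaryParameterOne {θ θ′ : ℝ} {σ ρ : ℕ → ℝ}
    (σ-cos : IsPseudoCosineFor θ σ) (ρ-cos : IsPseudoCosineFor θ′ ρ)
    (σ-nontrivial : Nontrivial σ) (ε≡1 : IsAuxiliary σ ρ 1r)
    where

    ρ⁺ : ℕ → ℝ
    ρ⁺ i = ρ i + ρ (suc i)

    Δσ*ρ⁺≡0 : ∀ {i} → i < D → (σ (suc i) - σ i) * ρ⁺ i ≡ 0r
    Δσ*ρ⁺≡0 {i} i<D = begin
      (σ′ - σ₀) * (ρ₀ + ρ′)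
        ≡⟨ solve 4 (λ σ₀ σ′ ρ₀ ρ′ → (σ′ :- σ₀) :* (ρ₀ :+ ρ′) :=
                                     (σ′ :* ρ′ :- σ₀ :* ρ₀) :- (σ₀ :* ρ′ :- σ′ :* ρ₀))
                   refl σ₀ σ′ ρ₀ ρ′ ⟩
      (σ′ * ρ′ - σ₀ * ρ₀) - (σ₀ * ρ′ - σ′ * ρ₀)
        ≡⟨ x≡y⇒x-y≡0 (trans (ε≡1 (suc i) (s≤s z≤n) i<D) (*-identityˡ _)) ⟩
      0r ∎
      where
      open ≡-Reasoning
      σ₀ σ′ ρ₀ ρ′ : ℝ
      σ₀ = σ i; σ′ = σ (suc i); ρ₀ = ρ i; ρ′ = ρ (suc i)

    ρ⁺≢0⇒σ-steady : ∀ {i} → i < D → ρ⁺ i ≢ 0r → σ (suc i) ≡ σ i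
    ρ⁺≢0⇒σ-steady i<D ρ⁺≢0 = x-y≡0⇒x≡y (x*y≡0⇒y≡0 ρ⁺≢0 (trans (*-comm _ _) (Δσ*ρ⁺≡0 i<D)))

    ρ⁺₀≡0 : 0 < D → ρ⁺ 0 ≡ 0r
    ρ⁺₀≡0 0<D = x*y≡0⇒y≡0 σ₁-σ₀≢0 (Δσ*ρ⁺≡0 0<D)
      where
      σ₁-σ₀≢0 : σ 1 - σ 0 ≢ 0r
      σ₁-σ₀≢0 eq = σ₁≢1 σ-cos σ-nontrivial 0<D (trans (x-y≡0⇒x≡y eq) (proj₁ σ-cos))

    θ′≡-k : 0 < D → θ′ ≡ - k
    θ′≡-k 0<D = begin
      θ′               ≡⟨ θ≡k*σ₁ ρ-cos 0<D ⟩
      k * ρ 1          ≡⟨ cong (k *_) ρ₁≡-1 ⟩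
      k * - 1r         ≡⟨ solve 2 (λ k u → k :* :- u := :- (k :* u)) refl k 1r ⟩
      - (k * 1r)       ≡⟨ cong -_ (*-identityʳ k) ⟩
      - k              ∎
      where
      open ≡-Reasoning
      ρ₁≡-1 : ρ 1 ≡ - 1r
      ρ₁≡-1 = trans (inverseʳ-unique (ρ 0) (ρ 1) (ρ⁺₀≡0 0<D)) (cong -_ (proj₁ ρ-cos))

    ρ⁺-recurrence : ∀ {i} → suc i < D →
      C (suc i) * ρ⁺ i + (A (suc i) + A (suc i)) * ρ (suc i) + B (suc i) * ρ⁺ (suc i) ≡ 0r
    ρ⁺-recurrence {i} lt = begin
      C (suc i) * ρ⁺ i + (A (suc i) + A (suc i)) * ρ (suc i) + B (suc i) * ρ⁺ (suc i)
                                     ≡⟨ recurrence-sums ρ-cos lt ⟩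
      (θ′ + k) * ρ (suc i)           ≡⟨ cong (λ u → (u + k) * ρ (suc i)) (θ′≡-k 0<D) ⟩
      (- k + k) * ρ (suc i)          ≡⟨ solve 2 (λ k y → (:- k :+ k) :* y := :0) refl k (ρ (suc i)) ⟩
      0r                             ∎
      where
      open ≡-Reasoning
      0<D : 0 < D
      0<D = ℕ.<-trans (s≤s z≤n) lt

    module FirstNonzeroA {s : ℕ} (t<D : suc s < D)
      (a-below : ∀ {i} → i ≤ s → a i ≡ 0) (aₜ≢0 : a (suc s) ≢ 0) where
      t : ℕ
      t = suc s

      private
        0<D : 0 < D
        0<D = ℕ.<-trans (s≤s z≤n) t<D

      ρ⁺-vanishes : ∀ {i} → i < t → ρ⁺ i ≡ 0r
      ρ⁺-vanishes {zero}  _            = ρ⁺₀≡0 0<D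
      ρ⁺-vanishes {suc i} (s≤s i+1≤s) = x*y≡0⇒y≡0 (fromℕ≢0 (b≢0 lt)) (begin
        b′ * w                             ≡⟨ solve 4 (λ b′ c′ y w →
                                                        b′ :* w := c′ :* :0 :+ (:0 :+ :0) :* y :+ b′ :* w)
                                                      refl b′ c′ y w ⟩
        c′ * 0r + (0r + 0r) * y + b′ * w   ≡⟨ subst₂ (λ u v → c′ * u + (v + v) * y + b′ * w ≡ 0r)
                                                     (ρ⁺-vanishes (ℕ.m≤n⇒m≤1+n i+1≤s)) (cong fromℕ (a-below i+1≤s))
                                                     (ρ⁺-recurrence lt) ⟩
        0r                                 ∎)
        where
        open ≡-Reasoning
        lt : suc i < D
        lt = ℕ.<-trans (s≤s i+1≤s) t<D
        b′ c′ y w : ℝ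
        b′ = B (suc i); c′ = C (suc i); y = ρ (suc i); w = ρ⁺ (suc i)

      ρ-alternates : ∀ i → i ≤ t → ρ i ≡ negOnePow i
      ρ-alternates zero    _       = proj₁ ρ-cos
      ρ-alternates (suc i) i+1≤t = trans (inverseʳ-unique (ρ i) (ρ (suc i)) (ρ⁺-vanishes i+1≤t))
                                         (cong -_ (ρ-alternates i (ℕ.<⇒≤ i+1≤t)))

      ρ⁺ₜ-equation : (A t + A t) * ρ t + B t * ρ⁺ t ≡ 0r
      ρ⁺ₜ-equation = begin
        (A t + A t) * ρ t + B t * ρ⁺ t              ≡⟨ solve 3 (λ c x y → x :+ y := c :* :0 :+ x :+ y)
                                                               refl (C t) ((A t + A t) * ρ t) (B t * ρ⁺ t) ⟩
        C t * 0r + (A t + A t) * ρ t + B t * ρ⁺ t   ≡⟨ subst (λ u → C t * u + (A t + A t) * ρ t + B t * ρ⁺ t ≡ 0r)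
                                                             (ρ⁺-vanishes (ℕ.n<1+n s)) (ρ⁺-recurrence t<D) ⟩
        0r                                          ∎
        where open ≡-Reasoning

      ρₜ≢0 : ρ t ≢ 0r
      ρₜ≢0 ρₜ≡0 = negOnePow≢0 t (trans (sym (ρ-alternates t ℕ.≤-refl)) ρₜ≡0)

      ρ⁺ₜ≢0 : ρ⁺ t ≢ 0r
      ρ⁺ₜ≢0 ρ⁺ₜ≡0 = ρₜ≢0 (x*y≡0⇒y≡0 2aₜ≢0 (begin
        (A t + A t) * ρ t                  ≡⟨ solve 2 (λ x b → x := x :+ b :* :0) refl ((A t + A t) * ρ t) (B t) ⟩
        (A t + A t) * ρ t + B t * 0r       ≡⟨ subst (λ u → (A t + A t) * ρ t + B t * u ≡ 0r)
                                                     ρ⁺ₜ≡0 ρ⁺ₜ-equation ⟩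
        0r                                 ∎))
        where
        open ≡-Reasoning
        2aₜ≢0 : A t + A t ≢ 0r
        2aₜ≢0 eq = fromℕ≢0 (λ 2aₜ≡0 → aₜ≢0 (ℕ.m+n≡0⇒m≡0 (a t) 2aₜ≡0))
                           (trans (fromℕ-+ (a t) (a t)) eq)

      ρₜ₊₁≢negOnePow : ρ (suc t) ≢ negOnePow (suc t)
      ρₜ₊₁≢negOnePow eq = ρ⁺ₜ≢0 (trans (cong₂ _+_ (ρ-alternates t ℕ.≤-refl) eq) (-‿inverseʳ (negOnePow t)))

      σₜ₊₁≡σₜ : σ (suc t) ≡ σ t
      σₜ₊₁≡σₜ = ρ⁺≢0⇒σ-steady t<D ρ⁺ₜ≢0

      obstruction≢0 : suc t < D → C (suc t) * (A t + A t) + (A (suc t) + A (suc t)) * (B t + A t + A t) ≢ 0r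
      obstruction≢0 lt = subst (_≢ 0r) fromℕ-W (fromℕ≢0 W≢0)
        where
        open ≡-Reasoning
        a′ : ℕ
        a′ = a (suc t)
        W : ℕ
        W = c (suc t) ℕ.* (a t ℕ.+ a t) ℕ.+ (a′ ℕ.+ a′) ℕ.* (b t ℕ.+ a t ℕ.+ a t)
        W≢0 : W ≢ 0
        W≢0 W≡0 with ℕ.m*n≡0⇒m≡0∨n≡0 (c (suc t)) (ℕ.m+n≡0⇒m≡0 _ W≡0)
        ... | inj₁ cₜ₊₁≡0 = c≢0 (ℕ.<⇒≤ lt) cₜ₊₁≡0
        ... | inj₂ 2aₜ≡0  = aₜ≢0 (ℕ.m+n≡0⇒m≡0 (a t) 2aₜ≡0)
        fromℕ-W : fromℕ W ≡ C (suc t) * (A t + A t) + (A (suc t) + A (suc t)) * (B t + A t + A t)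
        fromℕ-W = begin
          fromℕ W
            ≡⟨ fromℕ-+ (c (suc t) ℕ.* (a t ℕ.+ a t)) _ ⟩
          fromℕ (c (suc t) ℕ.* (a t ℕ.+ a t)) + fromℕ ((a′ ℕ.+ a′) ℕ.* (b t ℕ.+ a t ℕ.+ a t))
            ≡⟨ cong₂ _+_ (fromℕ-* (c (suc t)) _) (fromℕ-* (a′ ℕ.+ a′) _) ⟩
          C (suc t) * fromℕ (a t ℕ.+ a t) + fromℕ (a′ ℕ.+ a′) * fromℕ (b t ℕ.+ a t ℕ.+ a t)
            ≡⟨ cong₂ (λ u v → C (suc t) * u + v * fromℕ (b t ℕ.+ a t ℕ.+ a t))
                     (fromℕ-+ (a t) (a t)) (fromℕ-+ a′ a′) ⟩
          C (suc t) * (A t + A t) + (A (suc t) + A (suc t)) * fromℕ (b t ℕ.+ a t ℕ.+ a t)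
            ≡⟨ cong (λ u → C (suc t) * (A t + A t) + (A (suc t) + A (suc t)) * u)
                    (trans (fromℕ-+ (b t ℕ.+ a t) (a t)) (cong (_+ A t) (fromℕ-+ (b t) (a t)))) ⟩
          C (suc t) * (A t + A t) + (A (suc t) + A (suc t)) * (B t + A t + A t) ∎

      ρ⁺ₜ₊₁≢0 : suc t < D → ρ⁺ (suc t) ≢ 0r
      ρ⁺ₜ₊₁≢0 lt ρ⁺ₜ₊₁≡0 =
        ρₜ≢0 (x*y≡0⇒y≡0 (obstruction≢0 lt)
                        (two-step-obstruction ρ⁺ₜ-equation (ρ⁺-recurrence lt) ρ⁺ₜ₊₁≡0))

      σₜ₊₁≡0 : suc t < D → σ (suc t) ≡ 0r
      σₜ₊₁≡0 lt = x*y≡0⇒y≡0 (λ θ-k≡0 → θ≢k σ-cos σ-nontrivial 0<D (x-y≡0⇒x≡y θ-k≡0)) (begin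
        (θ - k) * σ (suc t)
          ≡⟨ recurrence-differences σ-cos lt ⟨
        c′ * (σ t - σ (suc t)) + b′ * (σ (suc (suc t)) - σ (suc t))
          ≡⟨ cong₂ (λ u v → c′ * u + b′ * v) (x≡y⇒x-y≡0 (sym σₜ₊₁≡σₜ))
                   (x≡y⇒x-y≡0 (ρ⁺≢0⇒σ-steady lt (ρ⁺ₜ₊₁≢0 lt))) ⟩
        c′ * 0r + b′ * 0r
          ≡⟨ solve 2 (λ b′ c′ → c′ :* :0 :+ b′ :* :0 := :0) refl b′ c′ ⟩
        0r ∎)
        where
        open ≡-Reasoning
        b′ c′ : ℝ
        b′ = B (suc t)
        c′ = C (suc t)

      t+1≮D : ¬ suc t < D
      t+1≮D lt = no-consecutive-zeros σ-cos t t<D (trans (sym σₜ₊₁≡σₜ) (σₜ₊₁≡0 lt)) (σₜ₊₁≡0 lt)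

      t+1≡D : suc t ≡ D
      t+1≡D = ℕ.≤-antisym t<D (ℕ.≮⇒≥ t+1≮D)

lemma8p2 : (R : RealField) (Γ : Graph) (D : ℕ) (p : ℕ → ℕ → ℕ → ℕ) →
    IsDistanceRegular Γ D p → 3 ≤ D →
    ¬ (∀ i → i ≤ D → Params.a p i ≡ 0) →
    ¬ (Params.a p D ≢ 0 × (∀ i → i < D → Params.a p i ≡ 0)) →
    (σ ρ : ℕ → RealField.ℝ R) →
    Seqs.IsPseudoCosine R D p σ → Seqs.IsPseudoCosine R D p ρ →
    Seqs.Nontrivial R D p σ → Seqs.Nontrivial R D p ρ →
    Seqs.TightPair R D p σ ρ →
    Seqs.IsAuxiliary R D p σ ρ (RealField.1r R) →
    ((∀ i → i < D → ρ i ≡ RealField.negOnePow R i) × ρ D ≢ RealField.negOnePow R D)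
    × σ (D ∸ 1) ≡ σ D
    × ((∀ i → i ≤ D ∸ 2 → Params.a p i ≡ 0) × Params.a p (D ∸ 1) ≢ 0)
lemma8p2 R Γ D p drg 3≤D not-bipartite not-almost-bipartite σ ρ (_ , σ-cos) (_ , ρ-cos) σ-nontrivial _ _ ε≡1 =
  from-first-nonzero (least-failure (λ i → a i ℕ.≟ 0) D)
  where
  open RealField R using (negOnePow)
  open Params p
  open IntersectionNumbers drg
  1≤D : 1 ≤ D
  1≤D = ℕ.≤-trans (s≤s z≤n) 3≤D
  open PseudoCosines R {D} {p} (a₀≡0 1≤D) b≢0 c≢0 a+b+c≡k
  open AuxiliaryParameterOne σ-cos ρ-cos σ-nontrivial ε≡1

  Conclusion : ℕ → Set
  Conclusion d = ((∀ i → i < d → ρ i ≡ negOnePow i) × ρ d ≢ negOnePow d)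
                 × σ (d ∸ 1) ≡ σ d × ((∀ i → i ≤ d ∸ 2 → a i ≡ 0) × a (d ∸ 1) ≢ 0)

  conclusion : ∀ {s} (t<D : suc s < D) (a-below : ∀ {i} → i ≤ s → a i ≡ 0) (aₜ≢0 : a (suc s) ≢ 0) →
               Conclusion (suc (suc s))
  conclusion t<D a-below aₜ≢0 =
    ((λ i i<t+1 → ρ-alternates i (ℕ.≤-pred i<t+1)) , ρₜ₊₁≢negOnePow)
    , sym σₜ₊₁≡σₜ
    , (λ _ → a-below) , aₜ≢0
    where open FirstNonzeroA t<D a-below aₜ≢0

  from-first-nonzero : (∀ i → i < D → a i ≡ 0) ⊎ ∃[ t ] (t < D × a t ≢ 0 × (∀ i → i < t → a i ≡ 0)) →
                       Conclusion D
  from-first-nonzero (inj₁ a<D≡0) with a D ℕ.≟ 0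
  ... | yes a_D≡0 =
    ⊥-elim (not-bipartite λ i i≤D → [ a<D≡0 i , (λ { refl → a_D≡0 }) ]′ (ℕ.m≤n⇒m<n∨m≡n i≤D))
  ... | no  a_D≢0 = ⊥-elim (not-almost-bipartite (a_D≢0 , a<D≡0))
  from-first-nonzero (inj₂ (zero , _ , a₀≢0 , _)) = ⊥-elim (a₀≢0 (a₀≡0 1≤D))
  from-first-nonzero (inj₂ (suc s , t<D , aₜ≢0 , below)) =
    subst Conclusion (FirstNonzeroA.t+1≡D t<D a-below aₜ≢0) (conclusion t<D a-below aₜ≢0)
    where
    a-below : ∀ {i} → i ≤ s → a i ≡ 0
    a-below i≤s = below _ (s≤s i≤s)
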